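{- Let $G$ be any one of the sequent calculi $\mathbf{GCE}$, $\mathbf{GCM}$, $\mathbf{GCMC}$, $\mathbf{GCEN}$, $\mathbf{GCMN}$, $\mathbf{GCK}$. Then contraction is admissible in $G$: if $G\vdash\Gamma,\phi,\phi\Rightarrow\Delta$ then $G\vdash\Gamma,\phi\Rightarrow\Delta$, and if $G\vdash\Gamma\Rightarrow\phi,\phi,\Delta$ then $G\vdash\Gamma\Rightarrow\phi,\Delta$. Moreover, $\bot$-elimination is admissible in $G$: if $G\vdash\Gamma\Rightarrow\bot,\Delta$ then $G\vdash\Gamma\Rightarrow\Delta$.
   Context: Formulas are those of $\mathcal{L}_{\triangleright}$: built from atoms and $\bot$ with $\wedge,\vee,\to$ and binary $\triangleright$. A sequent $\Gamma\Rightarrow\Delta$ has finite multisets $\Gamma,\Delta$ of formulas. $\mathbf{G3W}$ has the rules: axioms $\Gamma,p\Rightarrow p,\Delta$ ($p$ atomic) and $\Gamma,\bot\Rightarrow\Delta$; $L\wedge$: from $\Gamma,\phi,\psi\Rightarrow\Delta$ infer $\Gamma,\phi\wedge\psi\Rightarrow\Delta$; $R\wedge$: from $\Gamma\Rightarrow\phi,\Delta$ and $\Gamma\Rightarrow\psi,\Delta$ infer $\Gamma\Rightarrow\phi\wedge\psi,\Delta$; $L\vee$: from $\Gamma,\phi\Rightarrow\Delta$ and $\Gamma,\psi\Rightarrow\Delta$ infer $\Gamma,\phi\vee\psi\Rightarrow\Delta$; $R\vee$: from $\Gamma\Rightarrow\phi,\psi,\Delta$ infer $\Gamma\Rightarrow\phi\vee\psi,\Delta$;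 $L\to$: from $\Gamma\Rightarrow\phi,\Delta$ and $\Gamma,\psi\Rightarrow\Delta$ infer $\Gamma,\phi\to\psi\Rightarrow\Delta$; $R\to$: from $\Gamma,\phi\Rightarrow\psi,\Delta$ infer $\Gamma\Rightarrow\phi\to\psi,\Delta$; weakening $Lw$: from $\Gamma\Rightarrow\Delta$ infer $\Gamma,\phi\Rightarrow\Delta$; $Rw$: from $\Gamma\Rightarrow\Delta$ infer $\Gamma\Rightarrow\phi,\Delta$. Write $\alpha\Leftrightarrow\beta$ for the pair of premises $\alpha\Rightarrow\beta$ and $\beta\Rightarrow\alpha$. Conditional rules (no side contexts): $(CE)$: from $\phi_0\Leftrightarrow\phi_1$ and $\psi_0\Leftrightarrow\psi_1$ infer $\phi_1\triangleright\psi_1\Rightarrow\phi_0\triangleright\psi_0$; $(CM)$: from $\phi_0\Leftrightarrow\phi_1$ and $\psi_1\Rightarrow\psi_0$ infer $\phi_1\triangleright\psi_1\Rightarrow\phi_0\triangleright\psi_0$; $(CMC)$ ($n\ge1$): from $\phi_0\Leftrightarrow\phi_i$ for all $1\le i\le n$ and $\psi_1,\dots,\psi_n\Rightarrow\psi_0$ infer $\phi_1\triangleright\psi_1,\dots,\phi_n\triangleright\psi_n\Rightarrow\phi_0\triangleright\psi_0$; $(CN)$: from $\Rightarrow\psi_0$ infer $\Rightarrow\phi_0\triangleright\psi_0$. $\mathbf{GCE},\mathbf{GCM},\mathbf{GCMC}$ are $\mathbf{G3W}$ plus $(CE)$, $(CM)$, $(CMC)$ respectively; $\mathbf{GCEN},\mathbf{GCMN}$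 and $\mathbf{GCK}$ are $\mathbf{GCE},\mathbf{GCM},\mathbf{GCMC}$ plus $(CN)$, respectively. -}

module Defs where

open import Data.Nat using (ℕ)
open import Data.List using (List; []; _∷_; map)
open import Data.List.Relation.Unary.All using (All)
open import Data.List.Relation.Binary.Permutation.Propositional using (_↭_)
open import Data.Product using (_×_; _,_; proj₁; proj₂)

infixr 6 _∧_
infixr 5 _∨_
infixr 4 _⇒_
infix 7 _▷_

data Fm : Set where
  atom : ℕ → Fm
  ⊥'   : Fm
  _∧_  : Fm → Fm → Fm
  _∨_  : Fm → Fm → Fm
  _⇒_  : Fm → Fm → Fm
  _▷_  : Fm → Fm → Fm

data Calc : Set where
  GCE GCM GCMC GCEN GCMN GCK : Calc

data HasCE : Calc → Set where
  ce : HasCE GCE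
  cen : HasCE GCEN

data HasCM : Calc → Set where
  cm : HasCM GCM
  cmn : HasCM GCMN

data HasCMC : Calc → Set where
  cmc : HasCMC GCMC
  cmck : HasCMC GCK

data HasCN : Calc → Set where
  cnE : HasCN GCEN
  cnM : HasCN GCMN
  cnK : HasCN GCK

-- Sequents: antecedent and succedent are finite multisets, represented as
-- lists modulo permutation (rule 'perm' below).  "Γ , φ" is  φ ∷ Γ.
infix 3 _⊢_⇒_

data _⊢_⇒_ (G : Calc) : List Fm → List Fm → Set where
  perm : ∀ {Γ Γ' Δ Δ'} → Γ ↭ Γ' → Δ ↭ Δ' → G ⊢ Γ ⇒ Δ → G ⊢ Γ' ⇒ Δ'
  ax   : ∀ {Γ Δ} p → G ⊢ atom p ∷ Γ ⇒ atom p ∷ Δ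
  ax⊥  : ∀ {Γ Δ} → G ⊢ ⊥' ∷ Γ ⇒ Δ
  L∧   : ∀ {Γ Δ φ ψ} → G ⊢ φ ∷ ψ ∷ Γ ⇒ Δ → G ⊢ (φ ∧ ψ) ∷ Γ ⇒ Δ
  R∧   : ∀ {Γ Δ φ ψ} → G ⊢ Γ ⇒ φ ∷ Δ → G ⊢ Γ ⇒ ψ ∷ Δ → G ⊢ Γ ⇒ (φ ∧ ψ) ∷ Δ
  L∨   : ∀ {Γ Δ φ ψ} → G ⊢ φ ∷ Γ ⇒ Δ → G ⊢ ψ ∷ Γ ⇒ Δ → G ⊢ (φ ∨ ψ) ∷ Γ ⇒ Δ
  R∨   : ∀ {Γ Δ φ ψ} → G ⊢ Γ ⇒ φ ∷ ψ ∷ Δ → G ⊢ Γ ⇒ (φ ∨ ψ) ∷ Δ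
  L→   : ∀ {Γ Δ φ ψ} → G ⊢ Γ ⇒ φ ∷ Δ → G ⊢ ψ ∷ Γ ⇒ Δ → G ⊢ (φ ⇒ ψ) ∷ Γ ⇒ Δ
  R→   : ∀ {Γ Δ φ ψ} → G ⊢ φ ∷ Γ ⇒ ψ ∷ Δ → G ⊢ Γ ⇒ (φ ⇒ ψ) ∷ Δ
  Lw   : ∀ {Γ Δ φ} → G ⊢ Γ ⇒ Δ → G ⊢ φ ∷ Γ ⇒ Δ
  Rw   : ∀ {Γ Δ φ} → G ⊢ Γ ⇒ Δ → G ⊢ Γ ⇒ φ ∷ Δ
  CE   : ∀ {φ₀ φ₁ ψ₀ ψ₁} → HasCE G →
         G ⊢ φ₀ ∷ [] ⇒ φ₁ ∷ [] → G ⊢ φ₁ ∷ [] ⇒ φ₀ ∷ [] →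
         G ⊢ ψ₀ ∷ [] ⇒ ψ₁ ∷ [] → G ⊢ ψ₁ ∷ [] ⇒ ψ₀ ∷ [] →
         G ⊢ (φ₁ ▷ ψ₁) ∷ [] ⇒ (φ₀ ▷ ψ₀) ∷ []
  CM   : ∀ {φ₀ φ₁ ψ₀ ψ₁} → HasCM G →
         G ⊢ φ₀ ∷ [] ⇒ φ₁ ∷ [] → G ⊢ φ₁ ∷ [] ⇒ φ₀ ∷ [] →
         G ⊢ ψ₁ ∷ [] ⇒ ψ₀ ∷ [] →
         G ⊢ (φ₁ ▷ ψ₁) ∷ [] ⇒ (φ₀ ▷ ψ₀) ∷ []
  -- (CMC) with n ≥ 1: the list of pairs (φᵢ , ψᵢ) is  c ∷ cs
  CMC  : ∀ {φ₀ ψ₀} (c : Fm × Fm) (cs : List (Fm × Fm)) → HasCMC G →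
         All (λ d → G ⊢ φ₀ ∷ [] ⇒ proj₁ d ∷ []) (c ∷ cs) →
         All (λ d → G ⊢ proj₁ d ∷ [] ⇒ φ₀ ∷ []) (c ∷ cs) →
         G ⊢ map proj₂ (c ∷ cs) ⇒ ψ₀ ∷ [] →
         G ⊢ map (λ d → proj₁ d ▷ proj₂ d) (c ∷ cs) ⇒ (φ₀ ▷ ψ₀) ∷ []
  CN   : ∀ {φ₀ ψ₀} → HasCN G →
         G ⊢ [] ⇒ ψ₀ ∷ [] → G ⊢ [] ⇒ (φ₀ ▷ ψ₀) ∷ []

-- Left and right contraction are proved together by induction on the contracted formula φ,
-- with an inner induction on the derivation.  If no copy of φ is principal in the last rule,
-- contract in the premises and reapply the rule.  If one copy is principal, invert the
-- propositional rules to decompose the other copy in the premises, then contract the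
-- immediate subformulas by the outer hypothesis.  As these are smaller, inversion need not
-- be height-preserving, so a plain induction proves it despite the primitive weakenings.
-- Of the conditional rules only CMC can carry two copies of φ, both principal; there the
-- consequent is contracted.  Sequents are lists up to the rule perm, so every lemma on
-- derivations allows a permutation of the sequent.

module Submission where

open import Defs
open import Data.List using (List; []; _∷_; _++_; map)
open import Data.List.Membership.Propositional using (_∈_)
open import Data.List.Membership.Propositional.Properties using (∈-∃++; ∈-map⁻; ∈-++⁺ʳ)
open import Data.List.Relation.Unary.Any using (here; there)
open import Data.List.Relation.Unary.All using (All; _∷_)
open import Data.List.Relation.Binary.Permutation.Propositional
  using (_↭_; prep; swap; ↭-refl; ↭-sym; ↭-trans)
open import Data.List.Relation.Binary.Permutation.Propositional.Properties
  using (∈-resp-↭; All-resp-↭; drop-∷; shift; shifts; ++⁺ˡ; map⁺; ↭-empty-inv; ↭-singleton-inv)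
open import Data.Product using (_×_; _,_; proj₂; ∃)
open import Data.Sum using (_⊎_; inj₁; inj₂)
open import Data.Empty using (⊥; ⊥-elim)
open import Relation.Binary.PropositionalEquality using (_≡_; refl)

module _ {a} {A : Set a} where

  ∈⇒↭ : ∀ {x : A} {xs} → x ∈ xs → ∃ λ ys → xs ↭ x ∷ ys
  ∈⇒↭ x∈xs with ys , zs , refl ← ∈-∃++ x∈xs = ys ++ zs , shift _ ys zs

  split-∷ : ∀ {x y : A} {xs ys} → x ∷ xs ↭ y ∷ ys →
            (x ≡ y × xs ↭ ys) ⊎ (∃ λ zs → xs ↭ y ∷ zs × ys ↭ x ∷ zs)
  split-∷ p with ∈-resp-↭ p (here refl)
  ... | here refl = inj₁ (refl , drop-∷ p)
  ... | there x∈ys with zs , ys↭ ← ∈⇒↭ x∈ys =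
    inj₂ (zs , drop-∷ (↭-trans p (↭-trans (prep _ ys↭) (swap _ _ ↭-refl))) , ys↭)

  split-∷∷ : ∀ {x y : A} {xs ys} → x ∷ xs ↭ y ∷ y ∷ ys →
             (x ≡ y × xs ↭ y ∷ ys) ⊎ (∃ λ zs → xs ↭ y ∷ y ∷ zs × ys ↭ x ∷ zs)
  split-∷∷ p with split-∷ p
  ... | inj₁ result = inj₁ result
  ... | inj₂ (zs , xs↭ , yys↭) with split-∷ yys↭
  ...   | inj₁ (refl , ys↭zs) = inj₁ (refl , ↭-trans xs↭ (prep _ (↭-sym ys↭zs)))
  ...   | inj₂ (zs′ , ys↭ , zs↭) = inj₂ (zs′ , ↭-trans xs↭ (prep _ zs↭) , ys↭)

  prefix-shifts : ∀ xs ys {zs ws : List A} → zs ↭ ys ++ ws → xs ++ zs ↭ ys ++ xs ++ ws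
  prefix-shifts xs ys p = ↭-trans (++⁺ˡ xs p) (shifts xs ys)

  unshift : ∀ xs x {ys zs : List A} → zs ↭ x ∷ ys → x ∷ xs ++ ys ↭ xs ++ zs
  unshift xs x {ys} p = ↭-trans (↭-sym (shifts xs (x ∷ []) {ys})) (++⁺ˡ xs (↭-sym p))

  ∈-dedup : ∀ {x y : A} {xs} → x ∈ y ∷ y ∷ xs → x ∈ y ∷ xs
  ∈-dedup (here x≡y) = here x≡y
  ∈-dedup (there x∈) = x∈

module _ {a b} {A : Set a} {B : Set b} (f : A → B) where

  map-↭-∷ : ∀ {xs y ys} → map f xs ↭ y ∷ ys →
            ∃ λ x → ∃ λ xs′ → f x ≡ y × xs ↭ x ∷ xs′ × ys ↭ map f xs′
  map-↭-∷ p with x , x∈xs , refl ← ∈-map⁻ f (∈-resp-↭ (↭-sym p) (here refl))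
    with xs′ , xs↭ ← ∈⇒↭ x∈xs =
    x , xs′ , refl , xs↭ , drop-∷ (↭-trans (↭-sym p) (map⁺ f xs↭))

conditional : Fm × Fm → Fm
conditional (φ , ψ) = φ ▷ ψ

-- LeftPremise χ A B: some premise of the left rule for χ adds A to the antecedent and B to
-- the succedent (likewise on the right).  ⊥ on the right is given the premise Γ ⇒ Δ, so that
-- its inversion is ⊥-elimination.
data LeftPremise : Fm → List Fm → List Fm → Set where
  ∧⁻  : ∀ {a b} → LeftPremise (a ∧ b) (a ∷ b ∷ []) []
  ∨⁻ˡ : ∀ {a b} → LeftPremise (a ∨ b) (a ∷ []) []
  ∨⁻ʳ : ∀ {a b} → LeftPremise (a ∨ b) (b ∷ []) []
  ⇒⁻ˡ : ∀ {a b} → LeftPremise (a ⇒ b) [] (a ∷ [])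
  ⇒⁻ʳ : ∀ {a b} → LeftPremise (a ⇒ b) (b ∷ []) []

data RightPremise : Fm → List Fm → List Fm → Set where
  ⊥⁻  : RightPremise ⊥' [] []
  ∧⁻ˡ : ∀ {a b} → RightPremise (a ∧ b) [] (a ∷ [])
  ∧⁻ʳ : ∀ {a b} → RightPremise (a ∧ b) [] (b ∷ [])
  ∨⁻  : ∀ {a b} → RightPremise (a ∨ b) [] (a ∷ b ∷ [])
  ⇒⁻  : ∀ {a b} → RightPremise (a ⇒ b) (a ∷ []) (b ∷ [])

variable
  G : Calc
  Γ Δ Γ₁ Δ₁ A B : List Fm
  χ : Fm
  cs : List (Fm × Fm)

¬LeftPremise-conditional : LeftPremise χ A B → χ ∈ map conditional cs → ⊥
¬LeftPremise-conditional m χ∈ with _ , _ , refl ← ∈-map⁻ conditional χ∈ with () ← m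

¬RightPremise-conditional : RightPremise χ A B → χ ∈ map conditional cs → ⊥
¬RightPremise-conditional m χ∈ with _ , _ , refl ← ∈-map⁻ conditional χ∈ with () ← m

Lw⁺ : ∀ A → G ⊢ Γ ⇒ Δ → G ⊢ A ++ Γ ⇒ Δ
Lw⁺ []      d = d
Lw⁺ (_ ∷ A) d = Lw (Lw⁺ A d)

Rw⁺ : ∀ B → G ⊢ Γ ⇒ Δ → G ⊢ Γ ⇒ B ++ Δ
Rw⁺ []      d = d
Rw⁺ (_ ∷ B) d = Rw (Rw⁺ B d)

ax∈ : ∀ p → atom p ∈ Γ → atom p ∈ Δ → G ⊢ Γ ⇒ Δ
ax∈ p p∈Γ p∈Δ with _ , Γ↭ ← ∈⇒↭ p∈Γ with _ , Δ↭ ← ∈⇒↭ p∈Δ = perm (↭-sym Γ↭) (↭-sym Δ↭) (ax p)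

ax⊥∈ : ⊥' ∈ Γ → G ⊢ Γ ⇒ Δ
ax⊥∈ ⊥∈Γ with _ , Γ↭ ← ∈⇒↭ ⊥∈Γ = perm (↭-sym Γ↭) ↭-refl ax⊥

invertˡ : LeftPremise χ A B → G ⊢ Γ₁ ⇒ Δ₁ → Γ₁ ↭ χ ∷ Γ → Δ₁ ↭ Δ → G ⊢ A ++ Γ ⇒ B ++ Δ
invertˡ m (perm p q d) Γp Δp = invertˡ m d (↭-trans p Γp) (↭-trans q Δp)
invertˡ {A = A} {B} m (ax p) Γp Δp with ∈-resp-↭ Γp (here refl)
invertˡ () (ax p) Γp Δp | here refl
... | there p∈Γ = ax∈ p (∈-++⁺ʳ A p∈Γ) (∈-++⁺ʳ B (∈-resp-↭ Δp (here refl)))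
invertˡ {A = A} m ax⊥ Γp Δp with ∈-resp-↭ Γp (here refl)
invertˡ () ax⊥ Γp Δp | here refl
... | there ⊥∈Γ = ax⊥∈ (∈-++⁺ʳ A ⊥∈Γ)
invertˡ {χ = χ} {A = A} m (L∧ {φ = a} {ψ = b} d) Γp Δp with split-∷ Γp
invertˡ ∧⁻ (L∧ {φ = a} {ψ = b} d) Γp Δp | inj₁ (refl , q) = perm (prep a (prep b q)) Δp d
... | inj₂ (_ , q , r) =
  perm (unshift A _ r) ↭-refl (L∧ (perm (shifts A (a ∷ b ∷ [])) ↭-refl
    (invertˡ m d (prefix-shifts (a ∷ b ∷ []) (χ ∷ []) q) Δp)))
invertˡ {χ = χ} {A = A} m (L∨ {φ = a} {ψ = b} d e) Γp Δp with split-∷ Γp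
invertˡ ∨⁻ˡ (L∨ {φ = a} d e) Γp Δp | inj₁ (refl , q) = perm (prep a q) Δp d
invertˡ ∨⁻ʳ (L∨ {ψ = b} d e) Γp Δp | inj₁ (refl , q) = perm (prep b q) Δp e
... | inj₂ (_ , q , r) =
  perm (unshift A _ r) ↭-refl (L∨
    (perm (shifts A (a ∷ [])) ↭-refl (invertˡ m d (prefix-shifts (a ∷ []) (χ ∷ []) q) Δp))
    (perm (shifts A (b ∷ [])) ↭-refl (invertˡ m e (prefix-shifts (b ∷ []) (χ ∷ []) q) Δp)))
invertˡ {χ = χ} {A = A} {B} m (L→ {φ = a} {ψ = b} d e) Γp Δp with split-∷ Γp
invertˡ ⇒⁻ˡ (L→ {φ = a} d e) Γp Δp | inj₁ (refl , q) = perm q (prep a Δp) d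
invertˡ ⇒⁻ʳ (L→ {ψ = b} d e) Γp Δp | inj₁ (refl , q) = perm (prep b q) Δp e
... | inj₂ (_ , q , r) =
  perm (unshift A _ r) ↭-refl (L→
    (perm ↭-refl (shifts B (a ∷ [])) (invertˡ m d q (prep a Δp)))
    (perm (shifts A (b ∷ [])) ↭-refl (invertˡ m e (prefix-shifts (b ∷ []) (χ ∷ []) q) Δp)))
invertˡ {B = B} m (R∧ {φ = a} {ψ = b} d e) Γp Δp =
  perm ↭-refl (unshift B _ (↭-sym Δp)) (R∧
    (perm ↭-refl (shifts B (a ∷ [])) (invertˡ m d Γp ↭-refl))
    (perm ↭-refl (shifts B (b ∷ [])) (invertˡ m e Γp ↭-refl)))
invertˡ {B = B} m (R∨ {φ = a} {ψ = b} d) Γp Δp =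
  perm ↭-refl (unshift B _ (↭-sym Δp))
    (R∨ (perm ↭-refl (shifts B (a ∷ b ∷ [])) (invertˡ m d Γp ↭-refl)))
invertˡ {χ = χ} {A = A} {B} m (R→ {φ = a} {ψ = b} d) Γp Δp =
  perm ↭-refl (unshift B _ (↭-sym Δp)) (R→ (perm (shifts A (a ∷ [])) (shifts B (b ∷ []))
    (invertˡ m d (↭-trans (prep a Γp) (swap a χ ↭-refl)) ↭-refl)))
invertˡ {χ = χ} {A = A} {B} m (Lw {φ = x} d) Γp Δp with split-∷ Γp
... | inj₁ (refl , q) = Lw⁺ A (Rw⁺ B (perm q Δp d))
... | inj₂ (_ , q , r) = perm (unshift A x r) ↭-refl (Lw (invertˡ m d q Δp))
invertˡ {B = B} m (Rw {φ = x} d) Γp Δp =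
  perm ↭-refl (unshift B x (↭-sym Δp)) (Rw (invertˡ m d Γp ↭-refl))
invertˡ m (CE _ _ _ _ _) Γp Δp =
  ⊥-elim (¬LeftPremise-conditional m (∈-resp-↭ (↭-sym Γp) (here refl)))
invertˡ m (CM _ _ _ _) Γp Δp =
  ⊥-elim (¬LeftPremise-conditional m (∈-resp-↭ (↭-sym Γp) (here refl)))
invertˡ m (CMC _ _ _ _ _ _) Γp Δp =
  ⊥-elim (¬LeftPremise-conditional m (∈-resp-↭ (↭-sym Γp) (here refl)))
invertˡ m (CN _ _) Γp Δp with () ← ↭-empty-inv (↭-sym Γp)

invertʳ : RightPremise χ A B → G ⊢ Γ₁ ⇒ Δ₁ → Γ₁ ↭ Γ → Δ₁ ↭ χ ∷ Δ → G ⊢ A ++ Γ ⇒ B ++ Δ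
invertʳ m (perm p q d) Γp Δp = invertʳ m d (↭-trans p Γp) (↭-trans q Δp)
invertʳ {A = A} {B} m (ax p) Γp Δp with ∈-resp-↭ Δp (here refl)
invertʳ () (ax p) Γp Δp | here refl
... | there p∈Δ = ax∈ p (∈-++⁺ʳ A (∈-resp-↭ Γp (here refl))) (∈-++⁺ʳ B p∈Δ)
invertʳ {A = A} m ax⊥ Γp Δp = ax⊥∈ (∈-++⁺ʳ A (∈-resp-↭ Γp (here refl)))
invertʳ {A = A} m (L∧ {φ = a} {ψ = b} d) Γp Δp =
  perm (unshift A _ (↭-sym Γp)) ↭-refl
    (L∧ (perm (shifts A (a ∷ b ∷ [])) ↭-refl (invertʳ m d ↭-refl Δp)))
invertʳ {A = A} m (L∨ {φ = a} {ψ = b} d e) Γp Δp =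
  perm (unshift A _ (↭-sym Γp)) ↭-refl (L∨
    (perm (shifts A (a ∷ [])) ↭-refl (invertʳ m d ↭-refl Δp))
    (perm (shifts A (b ∷ [])) ↭-refl (invertʳ m e ↭-refl Δp)))
invertʳ {χ = χ} {A = A} {B} m (L→ {φ = a} {ψ = b} d e) Γp Δp =
  perm (unshift A _ (↭-sym Γp)) ↭-refl (L→
    (perm ↭-refl (shifts B (a ∷ [])) (invertʳ m d ↭-refl (↭-trans (prep a Δp) (swap a χ ↭-refl))))
    (perm (shifts A (b ∷ [])) ↭-refl (invertʳ m e ↭-refl Δp)))
invertʳ {A = A} m (Lw {φ = x} d) Γp Δp =
  perm (unshift A x (↭-sym Γp)) ↭-refl (Lw (invertʳ m d ↭-refl Δp))
invertʳ {χ = χ} {B = B} m (R∧ {φ = a} {ψ = b} d e) Γp Δp with split-∷ Δp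
invertʳ ∧⁻ˡ (R∧ {φ = a} d e) Γp Δp | inj₁ (refl , q) = perm Γp (prep a q) d
invertʳ ∧⁻ʳ (R∧ {ψ = b} d e) Γp Δp | inj₁ (refl , q) = perm Γp (prep b q) e
... | inj₂ (_ , q , r) =
  perm ↭-refl (unshift B _ r) (R∧
    (perm ↭-refl (shifts B (a ∷ [])) (invertʳ m d Γp (prefix-shifts (a ∷ []) (χ ∷ []) q)))
    (perm ↭-refl (shifts B (b ∷ [])) (invertʳ m e Γp (prefix-shifts (b ∷ []) (χ ∷ []) q))))
invertʳ {χ = χ} {B = B} m (R∨ {φ = a} {ψ = b} d) Γp Δp with split-∷ Δp
invertʳ ∨⁻ (R∨ {φ = a} {ψ = b} d) Γp Δp | inj₁ (refl , q) = perm Γp (prep a (prep b q)) d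
... | inj₂ (_ , q , r) =
  perm ↭-refl (unshift B _ r) (R∨ (perm ↭-refl (shifts B (a ∷ b ∷ []))
    (invertʳ m d Γp (prefix-shifts (a ∷ b ∷ []) (χ ∷ []) q))))
invertʳ {χ = χ} {A = A} {B} m (R→ {φ = a} {ψ = b} d) Γp Δp with split-∷ Δp
invertʳ ⇒⁻ (R→ {φ = a} {ψ = b} d) Γp Δp | inj₁ (refl , q) = perm (prep a Γp) (prep b q) d
... | inj₂ (_ , q , r) =
  perm ↭-refl (unshift B _ r) (R→ (perm (shifts A (a ∷ [])) (shifts B (b ∷ []))
    (invertʳ m d (prep a Γp) (prefix-shifts (b ∷ []) (χ ∷ []) q))))
invertʳ {A = A} {B} m (Rw {φ = x} d) Γp Δp with split-∷ Δp
... | inj₁ (refl , q) = Lw⁺ A (Rw⁺ B (perm Γp q d))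
... | inj₂ (_ , q , r) = perm ↭-refl (unshift B x r) (Rw (invertʳ m d Γp q))
invertʳ m (CE _ _ _ _ _) Γp Δp =
  ⊥-elim (¬RightPremise-conditional m (∈-resp-↭ (↭-sym Δp) (here refl)))
invertʳ m (CM _ _ _ _) Γp Δp =
  ⊥-elim (¬RightPremise-conditional m (∈-resp-↭ (↭-sym Δp) (here refl)))
invertʳ m (CMC _ _ _ _ _ _) Γp Δp =
  ⊥-elim (¬RightPremise-conditional m (∈-resp-↭ (↭-sym Δp) (here refl)))
invertʳ m (CN _ _) Γp Δp =
  ⊥-elim (¬RightPremise-conditional m (∈-resp-↭ (↭-sym Δp) (here refl)))

contractˡ : ∀ φ → G ⊢ Γ₁ ⇒ Δ₁ → Γ₁ ↭ φ ∷ φ ∷ Γ → Δ₁ ↭ Δ → G ⊢ φ ∷ Γ ⇒ Δ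
contractʳ : ∀ φ → G ⊢ Γ₁ ⇒ Δ₁ → Γ₁ ↭ Γ → Δ₁ ↭ φ ∷ φ ∷ Δ → G ⊢ Γ ⇒ φ ∷ Δ

contractˡ φ (perm p q d) Γp Δp = contractˡ φ d (↭-trans p Γp) (↭-trans q Δp)
contractˡ φ (ax p) Γp Δp = ax∈ p (∈-dedup (∈-resp-↭ Γp (here refl))) (∈-resp-↭ Δp (here refl))
contractˡ φ ax⊥ Γp Δp = ax⊥∈ (∈-dedup (∈-resp-↭ Γp (here refl)))
contractˡ φ (L∧ {φ = a} {ψ = b} d) Γp Δp with split-∷∷ Γp
... | inj₁ (refl , q) =
  L∧ (perm (swap b a ↭-refl) ↭-refl
    (contractˡ b
      (contractˡ a
        (invertˡ ∧⁻ d (↭-trans (prep a (prep b q)) (shifts (a ∷ b ∷ []) ((a ∧ b) ∷ []))) Δp)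
        (prep a (swap b a ↭-refl)) ↭-refl)
      (↭-trans (swap a b ↭-refl) (prep b (swap a b ↭-refl))) ↭-refl))
... | inj₂ (_ , q , r) =
  perm (unshift (φ ∷ []) _ r) ↭-refl (L∧ (perm (shifts (φ ∷ []) (a ∷ b ∷ [])) ↭-refl
    (contractˡ φ d (prefix-shifts (a ∷ b ∷ []) (φ ∷ φ ∷ []) q) Δp)))
contractˡ φ (L∨ {φ = a} {ψ = b} d e) Γp Δp with split-∷∷ Γp
... | inj₁ (refl , q) =
  L∨ (contractˡ a (invertˡ ∨⁻ˡ d (↭-trans (prep a q) (swap a (a ∨ b) ↭-refl)) Δp) ↭-refl ↭-refl)
     (contractˡ b (invertˡ ∨⁻ʳ e (↭-trans (prep b q) (swap b (a ∨ b) ↭-refl)) Δp) ↭-refl ↭-refl)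
... | inj₂ (_ , q , r) =
  perm (unshift (φ ∷ []) _ r) ↭-refl (L∨
    (perm (swap φ a ↭-refl) ↭-refl (contractˡ φ d (prefix-shifts (a ∷ []) (φ ∷ φ ∷ []) q) Δp))
    (perm (swap φ b ↭-refl) ↭-refl (contractˡ φ e (prefix-shifts (b ∷ []) (φ ∷ φ ∷ []) q) Δp)))
contractˡ φ (L→ {φ = a} {ψ = b} d e) Γp Δp with split-∷∷ Γp
... | inj₁ (refl , q) =
  L→ (contractʳ a (invertˡ ⇒⁻ˡ d q (prep a Δp)) ↭-refl ↭-refl)
     (contractˡ b (invertˡ ⇒⁻ʳ e (↭-trans (prep b q) (swap b (a ⇒ b) ↭-refl)) Δp) ↭-refl ↭-refl)
... | inj₂ (_ , q , r) =
  perm (unshift (φ ∷ []) _ r) ↭-refl (L→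
    (contractˡ φ d q (prep a Δp))
    (perm (swap φ b ↭-refl) ↭-refl (contractˡ φ e (prefix-shifts (b ∷ []) (φ ∷ φ ∷ []) q) Δp)))
contractˡ φ (R∧ d e) Γp Δp =
  perm ↭-refl Δp (R∧ (contractˡ φ d Γp ↭-refl) (contractˡ φ e Γp ↭-refl))
contractˡ φ (R∨ d) Γp Δp = perm ↭-refl Δp (R∨ (contractˡ φ d Γp ↭-refl))
contractˡ φ (R→ {φ = a} d) Γp Δp =
  perm ↭-refl Δp (R→ (perm (swap φ a ↭-refl) ↭-refl
    (contractˡ φ d (↭-trans (prep a Γp) (shifts (a ∷ []) (φ ∷ φ ∷ []))) ↭-refl)))
contractˡ φ (Lw {φ = x} d) Γp Δp with split-∷∷ Γp
... | inj₁ (refl , q) = perm q Δp d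
... | inj₂ (_ , q , r) = perm (unshift (φ ∷ []) x r) ↭-refl (Lw (contractˡ φ d q Δp))
contractˡ φ (Rw d) Γp Δp = perm ↭-refl Δp (Rw (contractˡ φ d Γp ↭-refl))
contractˡ φ (CE _ _ _ _ _) Γp Δp with () ← ↭-singleton-inv (↭-sym Γp)
contractˡ φ (CM _ _ _ _) Γp Δp with () ← ↭-singleton-inv (↭-sym Γp)
-- Both copies of φ = x ▷ y are principal: drop the premises of one copy and contract y
-- in the premise y, y, … ⇒ ψ₀.
contractˡ φ (CMC c cs has ⊢φᵢ ⊢φ₀ d) Γp Δp
  with (x , y) , _ , refl , s₁ , t₁ ← map-↭-∷ conditional Γp
  with _ , cs′ , refl , s₂ , t₂ ← map-↭-∷ conditional (↭-sym t₁) =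
  perm (prep _ (↭-sym t₂)) Δp
    (CMC (x , y) cs′ has (dropSecond (All-resp-↭ s ⊢φᵢ)) (dropSecond (All-resp-↭ s ⊢φ₀))
      (contractˡ y d (map⁺ proj₂ s) ↭-refl))
  where
  s : c ∷ cs ↭ (x , y) ∷ (x , y) ∷ cs′
  s = ↭-trans s₁ (prep _ s₂)
  dropSecond : ∀ {P : Fm × Fm → Set} {u v ws} → All P (u ∷ v ∷ ws) → All P (u ∷ ws)
  dropSecond (pu ∷ _ ∷ pws) = pu ∷ pws
contractˡ φ (CN _ _) Γp Δp with () ← ↭-empty-inv (↭-sym Γp)

contractʳ φ (perm p q d) Γp Δp = contractʳ φ d (↭-trans p Γp) (↭-trans q Δp)
contractʳ φ (ax p) Γp Δp = ax∈ p (∈-resp-↭ Γp (here refl)) (∈-dedup (∈-resp-↭ Δp (here refl)))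
contractʳ φ ax⊥ Γp Δp = ax⊥∈ (∈-resp-↭ Γp (here refl))
contractʳ φ (L∧ d) Γp Δp = perm Γp ↭-refl (L∧ (contractʳ φ d ↭-refl Δp))
contractʳ φ (L∨ d e) Γp Δp =
  perm Γp ↭-refl (L∨ (contractʳ φ d ↭-refl Δp) (contractʳ φ e ↭-refl Δp))
contractʳ φ (L→ {φ = a} d e) Γp Δp =
  perm Γp ↭-refl (L→
    (perm ↭-refl (swap φ a ↭-refl)
      (contractʳ φ d ↭-refl (↭-trans (prep a Δp) (shifts (a ∷ []) (φ ∷ φ ∷ [])))))
    (contractʳ φ e ↭-refl Δp))
contractʳ φ (Lw d) Γp Δp = perm Γp ↭-refl (Lw (contractʳ φ d ↭-refl Δp))
contractʳ φ (R∧ {φ = a} {ψ = b} d e) Γp Δp with split-∷∷ Δp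
... | inj₁ (refl , q) =
  R∧ (contractʳ a (invertʳ ∧⁻ˡ d Γp (↭-trans (prep a q) (swap a (a ∧ b) ↭-refl))) ↭-refl ↭-refl)
     (contractʳ b (invertʳ ∧⁻ʳ e Γp (↭-trans (prep b q) (swap b (a ∧ b) ↭-refl))) ↭-refl ↭-refl)
... | inj₂ (_ , q , r) =
  perm ↭-refl (unshift (φ ∷ []) _ r) (R∧
    (perm ↭-refl (swap φ a ↭-refl) (contractʳ φ d Γp (prefix-shifts (a ∷ []) (φ ∷ φ ∷ []) q)))
    (perm ↭-refl (swap φ b ↭-refl) (contractʳ φ e Γp (prefix-shifts (b ∷ []) (φ ∷ φ ∷ []) q))))
contractʳ φ (R∨ {φ = a} {ψ = b} d) Γp Δp with split-∷∷ Δp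
... | inj₁ (refl , q) =
  R∨ (perm ↭-refl (swap b a ↭-refl)
    (contractʳ b
      (contractʳ a
        (invertʳ ∨⁻ d Γp (↭-trans (prep a (prep b q)) (shifts (a ∷ b ∷ []) ((a ∨ b) ∷ []))))
        ↭-refl (prep a (swap b a ↭-refl)))
      ↭-refl (↭-trans (swap a b ↭-refl) (prep b (swap a b ↭-refl)))))
... | inj₂ (_ , q , r) =
  perm ↭-refl (unshift (φ ∷ []) _ r) (R∨ (perm ↭-refl (shifts (φ ∷ []) (a ∷ b ∷ []))
    (contractʳ φ d Γp (prefix-shifts (a ∷ b ∷ []) (φ ∷ φ ∷ []) q))))
contractʳ φ (R→ {φ = a} {ψ = b} d) Γp Δp with split-∷∷ Δp
... | inj₁ (refl , q) =
  R→ (contractʳ b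
       (contractˡ a (invertʳ ⇒⁻ d (prep a Γp) (↭-trans (prep b q) (swap b (a ⇒ b) ↭-refl)))
         ↭-refl ↭-refl)
       ↭-refl ↭-refl)
... | inj₂ (_ , q , r) =
  perm ↭-refl (unshift (φ ∷ []) _ r) (R→ (perm ↭-refl (swap φ b ↭-refl)
    (contractʳ φ d (prep a Γp) (prefix-shifts (b ∷ []) (φ ∷ φ ∷ []) q))))
contractʳ φ (Rw {φ = x} d) Γp Δp with split-∷∷ Δp
... | inj₁ (refl , q) = perm Γp q d
... | inj₂ (_ , q , r) = perm ↭-refl (unshift (φ ∷ []) x r) (Rw (contractʳ φ d Γp q))
contractʳ φ (CE _ _ _ _ _) Γp Δp with () ← ↭-singleton-inv (↭-sym Δp)
contractʳ φ (CM _ _ _ _) Γp Δp with () ← ↭-singleton-inv (↭-sym Δp)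
contractʳ φ (CMC _ _ _ _ _ _) Γp Δp with () ← ↭-singleton-inv (↭-sym Δp)
contractʳ φ (CN _ _) Γp Δp with () ← ↭-singleton-inv (↭-sym Δp)

mainTheorem2 : (G : Calc) →
    ((Γ Δ : List Fm) (φ : Fm) → G ⊢ φ ∷ φ ∷ Γ ⇒ Δ → G ⊢ φ ∷ Γ ⇒ Δ) ×
    ((Γ Δ : List Fm) (φ : Fm) → G ⊢ Γ ⇒ φ ∷ φ ∷ Δ → G ⊢ Γ ⇒ φ ∷ Δ) ×
    ((Γ Δ : List Fm) → G ⊢ Γ ⇒ ⊥' ∷ Δ → G ⊢ Γ ⇒ Δ)
mainTheorem2 G =
  (λ Γ Δ φ d → contractˡ φ d ↭-refl ↭-refl) ,
  (λ Γ Δ φ d → contractʳ φ d ↭-refl ↭-refl) ,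
  (λ Γ Δ d → invertʳ ⊥⁻ d ↭-refl ↭-refl)
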